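{- There is a computable total map $\Omega:\mathcal{T}\to\mathcal{T}$ such that: (1) for each $T\in\mathcal{T}$, $\Omega(T)\in\mathcal{D}_{\mathcal{T}}$; (2) if $T\in\mathcal{D}_{\mathcal{T}}$ then $\Omega(T)$ and $T$ compute the same map $\mathcal{T}\times\mathbb{N}\to\{\pm\}$, i.e. $T'=(\Omega(T))'$.
   Context: "Map" means partial map unless called total. $\mathcal{T}$ is the set of Turing machines $\mathbb{N}\to\mathbb{N}$ (identified with their partial functions) with a standard Gödel encoding $e_{\mathcal{T}}$; $\mathbb{N}$ is encoded by the identity, $\{\pm\}$ by $-\mapsto0,+\mapsto1$, products by $(a,b)\mapsto2^{e_A(a)}3^{e_B(b)}$. A map is computable if some Turing machine $T$ satisfies $e_{\text{target}}\circ f=T\circ e_{\text{source}}$ as partial maps. $\mathcal{D}_{\mathcal{T}}$ is the set of $T\in\mathcal{T}$ for which there is a map $T':\mathcal{T}\times\mathbb{N}\to\{\pm\}$ with $e_{\{\pm\}}\circ T'=T\circ e_{\mathcal{T}\times\mathbb{N}}$ (as partial maps); $T'$ is then unique. -}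

module Defs where

open import Data.Nat using (ℕ; zero; suc; _+_; _*_; _^_; _<ᵇ_)
open import Data.Bool using (if_then_else_)
open import Data.Product using (Σ; _×_; _,_; proj₁; proj₂)
open import Level using (0ℓ)
open import Function.Bundles using (_⇔_)
open import Relation.Binary.PropositionalEquality using (_≡_)

-- Model of computation.
-- "Turing machines ℕ → ℕ" are represented by codes of partial recursive
-- functions ℕ ⇀ ℕ (the standard unary basis used e.g. in Mathlib's
-- Nat.Partrec.Code), which compute exactly the Turing-computable
-- partial functions.  The machine-internal pairing is Szudzik's
-- bijection ℕ × ℕ ≅ ℕ.

npair : ℕ → ℕ → ℕ
npair a b = if a <ᵇ b then b * b + a else a * a + a + b

data Code : Set where
  zeroC  : Code
  succC  : Code
  leftC  : Code
  rightC : Code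
  pairC  : Code → Code → Code
  compC  : Code → Code → Code
  precC  : Code → Code → Code
  rfindC : Code → Code

-- Big-step semantics: Eval c n m  means  "machine c halts on input n
-- with output m".  This is a deterministic relation, i.e. the partial
-- function ℕ ⇀ ℕ computed by c.
data Eval : Code → ℕ → ℕ → Set where
  ev-zero  : ∀ {n} → Eval zeroC n 0
  ev-succ  : ∀ {n} → Eval succC n (suc n)
  ev-left  : ∀ {a b} → Eval leftC (npair a b) a
  ev-right : ∀ {a b} → Eval rightC (npair a b) b
  ev-pair  : ∀ {f g n a b} → Eval f n a → Eval g n b →
             Eval (pairC f g) n (npair a b)
  ev-comp  : ∀ {f g n m k} → Eval g n m → Eval f m k →
             Eval (compC f g) n k
  ev-prec0 : ∀ {f g a k} → Eval f a k →
             Eval (precC f g) (npair a 0) k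
  ev-precS : ∀ {f g a y i k} → Eval (precC f g) (npair a y) i →
             Eval g (npair a (npair y i)) k →
             Eval (precC f g) (npair a (suc y)) k
  -- rfindC f on npair a m: least n ≥ m with f (npair a n) = 0, where
  -- f (npair a j) is defined and nonzero for m ≤ j < n; output n.
  ev-rfind0 : ∀ {f a m} → Eval f (npair a m) 0 →
              Eval (rfindC f) (npair a m) m
  ev-rfindS : ∀ {f a m k r} → Eval f (npair a m) (suc k) →
              Eval (rfindC f) (npair a (suc m)) r →
              Eval (rfindC f) (npair a m) r

𝒯 : Set
𝒯 = Code

-- Standard Gödel encoding e_𝒯 (injective, in fact bijective).
e𝒯 : 𝒯 → ℕ
e𝒯 zeroC       = 0
e𝒯 succC       = 1
e𝒯 leftC       = 2
e𝒯 rightC      = 3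
e𝒯 (pairC f g) = 2 * (2 * npair (e𝒯 f) (e𝒯 g)) + 4
e𝒯 (compC f g) = 2 * (2 * npair (e𝒯 f) (e𝒯 g) + 1) + 4
e𝒯 (precC f g) = (2 * (2 * npair (e𝒯 f) (e𝒯 g))) + 1 + 4
e𝒯 (rfindC f)  = (2 * (2 * e𝒯 f + 1)) + 1 + 4

eℕ : ℕ → ℕ
eℕ n = n

data Sign : Set where
  minus plus : Sign

eSign : Sign → ℕ
eSign minus = 0
eSign plus  = 1

eProd : {A B : Set} → (A → ℕ) → (B → ℕ) → A × B → ℕ
eProd eA eB (a , b) = 2 ^ eA a * 3 ^ eB b

record PMap (A B : Set) : Set₁ where
  field
    graph      : A → B → Set
    functional : ∀ {a b b'} → graph a b → graph a b' → b ≡ b'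
open PMap public

totalPMap : {A B : Set} → (A → B) → PMap A B
totalPMap f = record
  { graph = λ a b → f a ≡ b
  ; functional = λ { _≡_.refl _≡_.refl → _≡_.refl } }

-- "e_B ∘ f = T ∘ e_A as partial maps": for every a ∈ A and y ∈ ℕ,
-- (e_B ∘ f)(a) is defined and equals y iff T halts on e_A(a) with output y.
Implements : {A B : Set} → (A → ℕ) → (B → ℕ) → 𝒯 → PMap A B → Set
Implements eA eB T f =
  ∀ a y → (Σ _ λ b → graph f a b × eB b ≡ y) ⇔ Eval T (eA a) y

Computable : {A B : Set} → (A → ℕ) → (B → ℕ) → PMap A B → Set
Computable eA eB f = Σ 𝒯 λ T → Implements eA eB T f

-- T' is a map 𝒯 × ℕ ⇀ {±} with e_{±} ∘ T' = T ∘ e_{𝒯×ℕ}.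
IsDeciderMap : 𝒯 → PMap (𝒯 × ℕ) Sign → Set
IsDeciderMap T T' = Implements (eProd e𝒯 eℕ) eSign T T'

InD : 𝒯 → Set₁
InD T = Σ (PMap (𝒯 × ℕ) Sign) λ T' → IsDeciderMap T T'

_≐_ : {A B : Set} → PMap A B → PMap A B → Set
f ≐ g = ∀ a b → graph f a b ⇔ graph g a b

{-# OPTIONS --safe #-}
-- Ω(T) post-composes T with the machine signC computing 0 ↦ 0, n + 1 ↦ 1.
-- All outputs of Ω(T) are codes of signs, so Ω(T) ∈ 𝒟; and if T ∈ 𝒟, the
-- outputs of T on encoded pairs are already codes of signs, which signC
-- fixes, so Ω(T) computes the same map. Ω is computable because
-- e𝒯 (compC f g) is an affine function of npair (e𝒯 f) (e𝒯 g), and pairing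
-- is a basic operation of the machine model. That two machines "compute the
-- same map" is meaningful because evaluation is deterministic, which in turn
-- rests on injectivity of Szudzik pairing.
module Submission where

open import Defs
open import Data.Bool as Bool using (true; false)
open import Data.Empty using (⊥-elim)
open import Data.Nat using (ℕ; suc; zero; _+_; _*_; _<ᵇ_; _≤_; _<_)
open import Data.Nat.Properties
open import Data.Nat.Tactic.RingSolver using (solve-∀)
open import Data.Product using (Σ; _×_; ∃₂; _,_; proj₁; proj₂)
open import Data.Sum using (_⊎_; inj₁; inj₂)
open import Data.Unit using (tt)
open import Function.Bundles using (_⇔_; mk⇔; Equivalence)
open import Function.Construct.Composition using (_⇔-∘_)
open import Function.Construct.Symmetry using (⇔-sym)
open import Relation.Binary using (tri<; tri≈; tri>)
open import Relation.Binary.PropositionalEquality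
  using (_≡_; _≢_; refl; sym; trans; cong; cong₂; subst)
open import Relation.Nullary using (yes; no)

npair-< : ∀ {a b} → a < b → npair a b ≡ b * b + a
npair-< {a} {b} a<b with a <ᵇ b | <⇒<ᵇ a<b
... | true | _ = refl

npair-≥ : ∀ {a b} → b ≤ a → npair a b ≡ a * a + (a + b)
npair-≥ {a} {b} b≤a with a <ᵇ b in eq
... | false = +-assoc (a * a) a b
... | true  = ⊥-elim (<⇒≱ (<ᵇ⇒< a b (subst Bool.T (sym eq) tt)) b≤a)

below-next-square : ∀ {s r} → r ≤ s + s → s * s + r < suc s * suc s
below-next-square {s} {r} r≤2s = begin-strict
  s * s + r             ≤⟨ +-monoʳ-≤ (s * s) r≤2s ⟩
  s * s + (s + s)       <⟨ n<1+n _ ⟩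
  suc (s * s + (s + s)) ≡⟨ next-square s ⟩
  suc s * suc s         ∎
  where
  open ≤-Reasoning
  next-square : ∀ s → suc (s * s + (s + s)) ≡ suc s * suc s
  next-square = solve-∀

square-plus-< : ∀ {s t r r'} → s < t → r ≤ s + s → s * s + r < t * t + r'
square-plus-< {s} {t} {r} {r'} s<t r≤2s = begin-strict
  s * s + r     <⟨ below-next-square {s} r≤2s ⟩
  suc s * suc s ≤⟨ *-mono-≤ s<t s<t ⟩
  t * t         ≤⟨ m≤m+n (t * t) r' ⟩
  t * t + r'    ∎
  where open ≤-Reasoning

square-plus-injective : ∀ {s t r r'} → s * s + r ≡ t * t + r' → r ≤ s + s → r' ≤ t + t →
                        s ≡ t × r ≡ r'
square-plus-injective {s} {t} {r} {r'} eq r≤2s r'≤2t with <-cmp s t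
... | tri< s<t _ _ = ⊥-elim (<-irrefl eq (square-plus-< s<t r≤2s))
... | tri≈ _ refl _ = refl , +-cancelˡ-≡ (s * s) r r' eq
... | tri> _ _ t<s = ⊥-elim (<-irrefl (sym eq) (square-plus-< t<s r'≤2t))

-- npair a b = s * s + r with s the larger of a, b and r ≤ s + s.
npair-shell : ∀ a b → a < b × npair a b ≡ b * b + a ⊎ b ≤ a × npair a b ≡ a * a + (a + b)
npair-shell a b with a <? b
... | yes a<b = inj₁ (a<b , npair-< a<b)
... | no  a≮b = inj₂ (≮⇒≥ a≮b , npair-≥ (≮⇒≥ a≮b))

lower-offset : ∀ {a b} → a < b → a ≤ b + b
lower-offset {a} {b} a<b = ≤-trans (<⇒≤ a<b) (m≤m+n b b)

upper-offset : ∀ {a b} → b ≤ a → a + b ≤ a + a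
upper-offset {a} b≤a = +-monoʳ-≤ a b≤a

shells-disjoint : ∀ {a b a' b'} → a < b → b' ≤ a' → b * b + a ≢ a' * a' + (a' + b')
shells-disjoint {a} {b} {a'} {b'} a<b b'≤a' eq
  with refl , refl ← square-plus-injective {b} {a'} eq (lower-offset a<b) (upper-offset b'≤a')
  = <⇒≱ a<b (m≤m+n b b')

npair-injective : ∀ {a b a' b'} → npair a b ≡ npair a' b' → a ≡ a' × b ≡ b'
npair-injective {a} {b} {a'} {b'} eq with npair-shell a b | npair-shell a' b'
... | inj₁ (a<b , e) | inj₁ (a'<b' , e')
  with refl , refl ← square-plus-injective {b} {b'} (trans (sym e) (trans eq e'))
                                            (lower-offset a<b) (lower-offset a'<b')
  = refl , refl
... | inj₁ (a<b , e) | inj₂ (b'≤a' , e') =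
  ⊥-elim (shells-disjoint a<b b'≤a' (trans (sym e) (trans eq e')))
... | inj₂ (b≤a , e) | inj₁ (a'<b' , e') =
  ⊥-elim (shells-disjoint a'<b' b≤a (trans (sym e') (trans (sym eq) e)))
... | inj₂ (b≤a , e) | inj₂ (b'≤a' , e')
  with refl , a+b≡a+b' ← square-plus-injective {a} {a'} (trans (sym e) (trans eq e'))
                                                 (upper-offset b≤a) (upper-offset b'≤a')
  = refl , +-cancelˡ-≡ a b b' a+b≡a+b'

npair-successor : ∀ a b → ∃₂ λ a' b' → npair a' b' ≡ suc (npair a b)
npair-successor a b with <-cmp a b
... | tri< a<b _ _ with m≤n⇒m<n∨m≡n a<b
...   | inj₁ 1+a<b =
  suc a , b , trans (npair-< 1+a<b) (trans (+-suc (b * b) a) (cong suc (sym (npair-< a<b))))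
...   | inj₂ refl  = suc a , 0 , trans (end-of-shell a) (cong suc (sym (npair-< a<b)))
  where
  end-of-shell : ∀ a → suc a * suc a + suc a + 0 ≡ suc (suc a * suc a + a)
  end-of-shell = solve-∀
npair-successor a b | tri≈ _ refl _ =
  0 , suc a , trans (next-shell a) (cong suc (sym (npair-≥ {a} ≤-refl)))
  where
  next-shell : ∀ a → suc a * suc a + 0 ≡ suc (a * a + (a + a))
  next-shell = solve-∀
npair-successor a b | tri> _ _ b<a =
  a , suc b , trans (npair-≥ b<a) (trans within-shell (cong suc (sym (npair-≥ (<⇒≤ b<a)))))
  where
  within-shell : a * a + (a + suc b) ≡ suc (a * a + (a + b))
  within-shell = trans (cong (a * a +_) (+-suc a b)) (+-suc (a * a) (a + b))

npair-surjective : ∀ n → ∃₂ λ a b → npair a b ≡ n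
npair-surjective zero = 0 , 0 , refl
npair-surjective (suc n) with npair-surjective n
... | a , b , refl = npair-successor a b

-- The inputs are related by an equation instead of being unified, since they
-- are npair-terms and npair is not a constructor.
Eval-deterministic : ∀ {c x x' y y'} → Eval c x y → Eval c x' y' → x ≡ x' → y ≡ y'
Eval-deterministic ev-zero ev-zero _ = refl
Eval-deterministic ev-succ ev-succ refl = refl
Eval-deterministic (ev-left {a} {b}) (ev-left {a'} {b'}) e = proj₁ (npair-injective {a} {b} {a'} {b'} e)
Eval-deterministic (ev-right {a} {b}) (ev-right {a'} {b'}) e = proj₂ (npair-injective {a} {b} {a'} {b'} e)
Eval-deterministic (ev-pair f g) (ev-pair f' g') refl =
  cong₂ npair (Eval-deterministic f f' refl) (Eval-deterministic g g' refl)
Eval-deterministic (ev-comp g f) (ev-comp g' f') e =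
  Eval-deterministic f f' (Eval-deterministic g g' e)
Eval-deterministic (ev-prec0 {a = a} f) (ev-prec0 {a = a'} f') e =
  Eval-deterministic f f' (proj₁ (npair-injective {a} {0} {a'} {0} e))
Eval-deterministic (ev-prec0 {a = a} _) (ev-precS {a = a'} {y = y'} _ _) e
  with () ← proj₂ (npair-injective {a} {0} {a'} {suc y'} e)
Eval-deterministic (ev-precS {a = a} {y = y} _ _) (ev-prec0 {a = a'} _) e
  with () ← proj₂ (npair-injective {a} {suc y} {a'} {0} e)
Eval-deterministic (ev-precS {a = a} {y = y} r g) (ev-precS {a = a'} {y = y'} r' g') e
  with refl , refl ← npair-injective {a} {suc y} {a'} {suc y'} e
  = Eval-deterministic g g' (cong (npair a) (cong (npair y) (Eval-deterministic r r' refl)))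
Eval-deterministic (ev-rfind0 {a = a} {m = m} _) (ev-rfind0 {a = a'} {m = m'} _) e =
  proj₂ (npair-injective {a} {m} {a'} {m'} e)
Eval-deterministic (ev-rfind0 f) (ev-rfindS f' _) e with () ← Eval-deterministic f f' e
Eval-deterministic (ev-rfindS f _) (ev-rfind0 f') e with () ← Eval-deterministic f f' e
Eval-deterministic (ev-rfindS {a = a} {m = m} _ r) (ev-rfindS {a = a'} {m = m'} _ r') e
  with refl , refl ← npair-injective {a} {m} {a'} {m'} e
  = Eval-deterministic r r' refl

idC : Code
idC = pairC leftC rightC

Eval-idC : ∀ n → Eval idC n n
Eval-idC n with a , b , refl ← npair-surjective n = ev-pair (ev-left {a} {b}) (ev-right {a} {b})

constC : ℕ → Code
constC zero    = zeroC
constC (suc c) = compC succC (constC c)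

Eval-constC : ∀ c {x} → Eval (constC c) x c
Eval-constC zero    = ev-zero
Eval-constC (suc c) = ev-comp (Eval-constC c) ev-succ

addC : Code
addC = precC idC (compC succC (compC rightC rightC))

Eval-addC : ∀ a b → Eval addC (npair a b) (b + a)
Eval-addC a zero    = ev-prec0 (Eval-idC a)
Eval-addC a (suc b) = ev-precS (Eval-addC a b)
  (ev-comp (ev-comp (ev-right {a} {npair b (b + a)}) (ev-right {b} {b + a})) ev-succ)

plusC : Code → Code → Code
plusC G H = compC addC (pairC H G)

Eval-plusC : ∀ {G H x u v} → Eval G x u → Eval H x v → Eval (plusC G H) x (u + v)
Eval-plusC {u = u} {v} g h = ev-comp (ev-pair h g) (Eval-addC v u)

scaleC : ℕ → Code → Code
scaleC zero    G = zeroC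
scaleC (suc k) G = plusC G (scaleC k G)

Eval-scaleC : ∀ k {G x u} → Eval G x u → Eval (scaleC k G) x (k * u)
Eval-scaleC zero    g = ev-zero
Eval-scaleC (suc k) g = Eval-plusC g (Eval-scaleC k g)

affineC : ℕ → ℕ → Code → Code
affineC k c G = plusC (scaleC k G) (constC c)

Eval-affineC : ∀ k c {G x u} → Eval G x u → Eval (affineC k c G) x (k * u + c)
Eval-affineC k c g = Eval-plusC (Eval-scaleC k g) (Eval-constC c)

postcompC : Code → Code
postcompC f = affineC 2 4 (affineC 2 1 (pairC (constC (e𝒯 f)) idC))

Eval-postcompC : ∀ f g → Eval (postcompC f) (e𝒯 g) (e𝒯 (compC f g))
Eval-postcompC f g =
  Eval-affineC 2 4 (Eval-affineC 2 1 (ev-pair (Eval-constC (e𝒯 f)) (Eval-idC (e𝒯 g))))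

totalPMap-computable : ∀ {A B : Set} {eA : A → ℕ} {eB : B → ℕ} (F : A → B) (T : 𝒯) →
                       (∀ a → Eval T (eA a) (eB (F a))) → Computable eA eB (totalPMap F)
totalPMap-computable F T evalT = T , λ a y → mk⇔
  (λ { (_ , refl , refl) → evalT a })
  (λ evalT' → F a , refl , Eval-deterministic (evalT a) evalT' refl)

compC-computable : ∀ f → Computable e𝒯 e𝒯 (totalPMap (compC f))
compC-computable f = totalPMap-computable (compC f) (postcompC f) (Eval-postcompC f)

SignCode : ℕ → Set
SignCode y = Σ Sign λ b → eSign b ≡ y

eSign-injective : ∀ {b b'} → eSign b ≡ eSign b' → b ≡ b'
eSign-injective {minus} {minus} _ = refl
eSign-injective {plus}  {plus}  _ = refl

-- Primitive recursion on npair 0 n, with value 0 at n = 0 and 1 otherwise.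
signC : Code
signC = compC (precC zeroC (constC 1)) (pairC zeroC idC)

signC-sign-valued : ∀ {x y} → Eval signC x y → SignCode y
signC-sign-valued (ev-comp _ (ev-prec0 ev-zero)) = minus , refl
signC-sign-valued (ev-comp _ (ev-precS _ (ev-comp ev-zero ev-succ))) = plus , refl

signC-fixes-signs : ∀ b → Eval signC (eSign b) (eSign b)
signC-fixes-signs minus = ev-comp (ev-pair ev-zero (Eval-idC 0)) (ev-prec0 {a = 0} ev-zero)
signC-fixes-signs plus  = ev-comp (ev-pair ev-zero (Eval-idC 1))
  (ev-precS {a = 0} {y = 0} {i = 0} (ev-prec0 {a = 0} ev-zero) (ev-comp ev-zero ev-succ))

sign-valued⇒InD : ∀ {T} → (∀ {x y} → Eval T x y → SignCode y) → InD T
sign-valued⇒InD {T} signed = decider , λ p y → mk⇔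
  (λ { (b , evalT , refl) → evalT })
  (λ evalT → let b , eb≡y = signed evalT in b , subst (Eval T _) (sym eb≡y) evalT , eb≡y)
  where
  decider : PMap (𝒯 × ℕ) Sign
  decider = record
    { graph      = λ p b → Eval T (eProd e𝒯 eℕ p) (eSign b)
    ; functional = λ evalT evalT' → eSign-injective (Eval-deterministic evalT evalT' refl)
    }

decider-graph : ∀ {T F} → IsDeciderMap T F →
                ∀ p b → graph F p b ⇔ Eval T (eProd e𝒯 eℕ p) (eSign b)
decider-graph {F = F} D p b = mk⇔
  (λ Fpb → Equivalence.to (D p (eSign b)) (b , Fpb , refl))
  (λ evalT → let b' , Fpb' , eb'≡eb = Equivalence.from (D p (eSign b)) evalT
             in subst (graph F p) (eSign-injective eb'≡eb) Fpb')

decider-sign-valued : ∀ {T F} → IsDeciderMap T F →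
                      ∀ p {y} → Eval T (eProd e𝒯 eℕ p) y → SignCode y
decider-sign-valued D p {y} evalT =
  let b , _ , eb≡y = Equivalence.from (D p y) evalT in b , eb≡y

deciders-agree : ∀ {T T' F G} → IsDeciderMap T F → IsDeciderMap T' G →
                 (∀ p b → Eval T (eProd e𝒯 eℕ p) (eSign b) ⇔ Eval T' (eProd e𝒯 eℕ p) (eSign b)) →
                 F ≐ G
deciders-agree {T} {T'} {F} {G} DF DG agree p b =
  ⇔-sym (decider-graph {T'} {G} DG p b) ⇔-∘ (agree p b ⇔-∘ decider-graph {T} {F} DF p b)

compC-signC-sign-valued : ∀ {T x y} → Eval (compC signC T) x y → SignCode y
compC-signC-sign-valued (ev-comp _ s) = signC-sign-valued s

compC-signC-agrees : ∀ {T x b} → (∀ {y} → Eval T x y → SignCode y) →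
                     Eval T x (eSign b) ⇔ Eval (compC signC T) x (eSign b)
compC-signC-agrees {T} {x} {b} signed =
  mk⇔ (λ evalT → ev-comp evalT (signC-fixes-signs b)) unfilter
  where
  unfilter : Eval (compC signC T) x (eSign b) → Eval T x (eSign b)
  unfilter (ev-comp evalT s) with c , refl ← signed evalT =
    subst (Eval T x) (Eval-deterministic (signC-fixes-signs c) s refl) evalT

lemma4p1 : Σ (𝒯 → 𝒯) λ Ω →
    Computable e𝒯 e𝒯 (totalPMap Ω)
    × ((T : 𝒯) → InD (Ω T))
    × ((T : 𝒯) → InD T →
    (T'₁ T'₂ : PMap (𝒯 × ℕ) Sign) →
    IsDeciderMap T T'₁ → IsDeciderMap (Ω T) T'₂ → T'₁ ≐ T'₂)
lemma4p1 =
    compC signC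
  , compC-computable signC
  , (λ T → sign-valued⇒InD (compC-signC-sign-valued {T}))
  , λ T _ T'₁ T'₂ D₁ D₂ → deciders-agree {F = T'₁} {T'₂} D₁ D₂ λ p b →
      compC-signC-agrees (decider-sign-valued {F = T'₁} D₁ p)
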